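{- Let $G$ be a connected graph with vertex set $X$ that is regular of degree two and triangle free, equipped with the graph metric $d$. Then a function $f\colon X\to\mathbb{R}$ is subharmonic if and only if it is convex.
   Context: The graph metric $d(x,y)$ is the length of a shortest path between $x$ and $y$. A point $z$ is in between $x$ and $y$ if $d(x,y)=d(x,z)+d(z,y)$. A function $f$ is convex if for every $z\in X$, $f(z)\le\frac{d(y,z)}{d(x,y)}f(x)+\frac{d(x,z)}{d(x,y)}f(y)$ for all distinct $x,y\in X$ with $z$ in between $x$ and $y$. $f$ is subharmonic if $f(x)\le\frac{1}{\deg(x)}\sum_{y\sim x}f(y)$ for every $x\in X$. -}

module Defs where

open import Data.Nat as ℕ using (ℕ; zero; suc)
open import Data.List using (List; length; map; foldr)
open import Data.List.Membership.Propositional using (_∈_)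
open import Data.List.Relation.Unary.Unique.Propositional using (Unique)
open import Data.Product using (Σ; ∃; _×_; _,_)
open import Relation.Binary.PropositionalEquality using (_≡_; _≢_)
open import Relation.Binary.Structures using (IsTotalOrder)
open import Algebra.Structures using (IsCommutativeRing)
open import Relation.Nullary using (¬_)

-- Ordered fields (the scalars; ℝ is an instance).  Equality is _≡_.
-- The inverse is a total function; only x ≢ 0# → x * x ⁻¹ ≡ 1# is assumed.

record OrderedField : Set₁ where
  infixl 6 _+_
  infixl 7 _*_
  infix 4 _≤_
  field
    K : Set
    _+_ _*_ : K → K → K
    -_ : K → K
    _⁻¹ : K → K
    0# 1# : K
    _≤_ : K → K → Set
    isCommutativeRing : IsCommutativeRing _≡_ _+_ _*_ -_ 0# 1#
    isTotalOrder : IsTotalOrder _≡_ _≤_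
    0≢1 : 0# ≢ 1#
    *-inverse : ∀ x → x ≢ 0# → x * (x ⁻¹) ≡ 1#
    +-mono-≤ : ∀ x y z → x ≤ y → x + z ≤ y + z
    *-nonneg : ∀ x y → 0# ≤ x → 0# ≤ y → 0# ≤ x * y

  fromℕ : ℕ → K
  fromℕ zero = 0#
  fromℕ (suc n) = 1# + fromℕ n

  sumK : List K → K
  sumK = foldr _+_ 0#

-- Locally finite simple graphs: each vertex has a finite duplicate-free
-- list of neighbours; adjacency is membership in that list.

record Graph : Set₁ where
  field
    X : Set
    nbrs : X → List X
    nbrs-unique : ∀ x → Unique (nbrs x)

  _∼_ : X → X → Set
  x ∼ y = y ∈ nbrs x

  field
    ∼-sym : ∀ {x y} → x ∼ y → y ∼ x
    ∼-irrefl : ∀ {x} → ¬ (x ∼ x)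

  deg : X → ℕ
  deg x = length (nbrs x)

  data Walk : X → X → ℕ → Set where
    [] : ∀ {x} → Walk x x 0
    _∷_ : ∀ {x y z n} → x ∼ y → Walk y z n → Walk x z (suc n)

  Connected : Set
  Connected = ∀ x y → ∃ λ n → Walk x y n

  RegularOfDegree : ℕ → Set
  RegularOfDegree k = ∀ x → deg x ≡ k

  TriangleFree : Set
  TriangleFree = ∀ x y z → x ∼ y → y ∼ z → z ∼ x → Data.Empty.⊥
    where import Data.Empty

  Dist : X → X → ℕ → Set
  Dist x y n = Walk x y n × (∀ m → Walk x y m → n ℕ.≤ m)

  Between : X → X → X → ℕ → ℕ → ℕ → Set
  Between x y z a b c = Dist x z a × Dist z y b × Dist x y c × c ≡ a ℕ.+ b

module _ (F : OrderedField) (G : Graph) where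
  open OrderedField F
  open Graph G

  Subharmonic : (X → K) → Set
  Subharmonic f = ∀ x → f x ≤ (fromℕ (deg x)) ⁻¹ * sumK (map f (nbrs x))

  Convex : (X → K) → Set
  Convex f = ∀ x y z a b c → x ≢ y → Between x y z a b c →
             f z ≤ fromℕ b * (fromℕ c) ⁻¹ * f x + fromℕ a * (fromℕ c) ⁻¹ * f y

module Submission where

-- Along a shortest walk x = v₀, v₁, …, v_c = y in a 2-regular
-- graph, every inner vertex v_{k+1} has exactly the two neighbours v_k and
-- v_{k+2}; they are distinct because a shortest walk never backtracks.  So
-- subharmonicity at v_{k+1} says 2 f(v_{k+1}) ≤ f(v_k) + f(v_{k+2}): the
-- sequence g k = f(v_k) is midpoint convex, i.e. its increments are
-- non-decreasing, and such a sequence lies below its chord,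
-- c·g(a) ≤ b·g(0) + a·g(c) for a + b = c.  Dividing by c gives convexity at
-- any z on a geodesic from x to y.  Conversely, the two neighbours p, q of
-- x are distinct and, the graph being triangle free, at distance 2 with x
-- between them; convexity for this triple is subharmonicity at x.

open import Defs
open import Function.Bundles using (_⇔_; mk⇔)
open import Data.Nat as ℕ using (ℕ; zero; suc; z≤n; s≤s; _≤′_; ≤′-reflexive; ≤′-step)
import Data.Nat.Properties as ℕₚ
open import Data.List using (List; []; _∷_; length; map)
open import Data.List.Membership.Propositional using (_∈_)
open import Data.List.Relation.Unary.Any using (here; there)
open import Data.List.Relation.Unary.All using ([]; _∷_)
open import Data.List.Relation.Unary.AllPairs using (_∷_)
open import Data.List.Relation.Unary.Unique.Propositional using (Unique)
open import Data.Product using (∃₂; _×_; _,_)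
open import Data.Sum using (inj₁; inj₂)
open import Data.Empty using (⊥-elim)
open import Data.Maybe using (nothing)
open import Relation.Binary.PropositionalEquality
  using (_≡_; _≢_; refl; sym; trans; cong; cong₂; subst; subst₂)
open import Relation.Nullary using (¬_)
open import Relation.Binary.Bundles using (Poset)
open import Relation.Binary.Structures using (IsTotalOrder)
open import Algebra.Bundles using (CommutativeRing)
open import Algebra.Structures using (IsCommutativeRing)
open import Tactic.RingSolver.Core.AlmostCommutativeRing using (AlmostCommutativeRing; fromCommutativeRing)
open import Tactic.RingSolver using (solve-∀)
import Relation.Binary.Reasoning.PartialOrder as PosetReasoning

pair-of-distinct : ∀ {A : Set} (l : List A) → Unique l → length l ≡ 2 →
                   ∃₂ λ p q → p ∈ l × q ∈ l × p ≢ q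
pair-of-distinct (p ∷ q ∷ []) ((p≢q ∷ []) ∷ _) refl = p , q , here refl , there (here refl) , p≢q

-- The solver works with coefficients in K itself, where 1# + - 1# does not
-- compute to 0#, so only identities free of constants and of cancellations
-- are proved this way; the others are derived by hand below.
module RingIdentities (F : OrderedField) where
  private
    acr : AlmostCommutativeRing _ _
    acr = fromCommutativeRing (record { isCommutativeRing = OrderedField.isCommutativeRing F }) (λ _ → nothing)
  open AlmostCommutativeRing acr

  regroup : ∀ u v p q → (u + v) + (p + q) ≡ (u + p) + (v + q)
  regroup = solve-∀ acr

  add-one-more : ∀ u n s → (u + n * s) + s ≡ u + (s + n * s)
  add-one-more = solve-∀ acr

  split-sum : ∀ a b u → (a + b) * u ≡ b * u + a * u
  split-sum = solve-∀ acr

  shift-chord : ∀ a b u v s → b * (u + a * s) + a * v ≡ b * u + a * (v + b * s)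
  shift-chord = solve-∀ acr

module OrderedFieldFacts (F : OrderedField) where
  open OrderedField F
  open IsCommutativeRing isCommutativeRing
    using (+-comm; +-assoc; +-identityˡ; +-identityʳ; -‿inverseˡ; -‿inverseʳ;
           *-identityˡ; *-assoc; *-comm; distribˡ; distribʳ; zeroˡ)
  open IsTotalOrder isTotalOrder using (total; antisym; isPartialOrder)
  open IsTotalOrder isTotalOrder public
    using () renaming (refl to ≤-refl; trans to ≤-trans; reflexive to ≤-reflexive)

  commutativeRing : CommutativeRing _ _
  commutativeRing = record { isCommutativeRing = isCommutativeRing }

  open import Algebra.Properties.Ring (CommutativeRing.ring commutativeRing)
    using (-‿involutive; -1*x≈-x; -‿distribʳ-*; x[y-z]≈xy-xz)

  poset : Poset _ _ _
  poset = record { isPartialOrder = isPartialOrder }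

  open PosetReasoning poset public

  infixl 6 _−_
  _−_ : K → K → K
  y − x = y + - x

  open RingIdentities F

  +-− : ∀ x y → x + (y − x) ≡ y
  +-− x y = begin-equality
    x + (y + - x)   ≡⟨ +-comm x _ ⟩
    (y + - x) + x   ≡⟨ +-assoc y (- x) x ⟩
    y + (- x + x)   ≡⟨ cong (y +_) (-‿inverseˡ x) ⟩
    y + 0#          ≡⟨ +-identityʳ y ⟩
    y               ∎

  +-monoʳ-≤ : ∀ z {x y} → x ≤ y → z + x ≤ z + y
  +-monoʳ-≤ z {x} {y} x≤y = subst₂ _≤_ (+-comm x z) (+-comm y z) (+-mono-≤ x y z x≤y)

  +-mono₂-≤ : ∀ {x y u v} → x ≤ y → u ≤ v → x + u ≤ y + v
  +-mono₂-≤ {x} {y} {u} {v} x≤y u≤v = ≤-trans (+-mono-≤ x y u x≤y) (+-monoʳ-≤ y u≤v)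

  ≤⇒0≤− : ∀ {x y} → x ≤ y → 0# ≤ y − x
  ≤⇒0≤− {x} {y} x≤y = subst (_≤ y − x) (-‿inverseʳ x) (+-mono-≤ x y (- x) x≤y)

  0≤−⇒≤ : ∀ {x y} → 0# ≤ y − x → x ≤ y
  0≤−⇒≤ {x} {y} 0≤y−x =
    subst₂ _≤_ (+-identityˡ x) (trans (+-comm _ x) (+-− x y)) (+-mono-≤ 0# (y − x) x 0≤y−x)

  exchange : ∀ {u v p q} → u + v ≤ p + q → u − p ≤ q − v
  exchange {u} {v} {p} {q} ineq = subst₂ _≤_ left right (+-mono-≤ _ _ (- p + - v) ineq)
    where
    cancelʳ : ∀ a x → a + (x + - x) ≡ a
    cancelʳ a x = trans (cong (a +_) (-‿inverseʳ x)) (+-identityʳ a)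
    left : (u + v) + (- p + - v) ≡ u − p
    left = trans (regroup u v (- p) (- v)) (cancelʳ _ v)
    right : (p + q) + (- p + - v) ≡ q − v
    right = trans (regroup p q (- p) (- v)) (trans (+-comm _ _) (cancelʳ _ p))

  *-monoˡ-≤ : ∀ {c x y} → 0# ≤ c → x ≤ y → c * x ≤ c * y
  *-monoˡ-≤ {c} {x} {y} 0≤c x≤y =
    0≤−⇒≤ (subst (0# ≤_) (x[y-z]≈xy-xz c y x) (*-nonneg c (y − x) 0≤c (≤⇒0≤− x≤y)))

  -- 1 is positive: were 1 ≤ 0, then 0 ≤ (-1)·(-1) = 1 anyway.
  0≤1 : 0# ≤ 1#
  0≤1 with total 0# 1#
  ... | inj₁ 0≤1 = 0≤1
  ... | inj₂ 1≤0 = subst (0# ≤_) minus-one-squared (*-nonneg (- 1#) (- 1#) 0≤-1 0≤-1)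
    where
    0≤-1 : 0# ≤ - 1#
    0≤-1 = subst (0# ≤_) (+-identityˡ (- 1#)) (≤⇒0≤− 1≤0)
    minus-one-squared : - 1# * - 1# ≡ 1#
    minus-one-squared = trans (-1*x≈-x (- 1#)) (-‿involutive 1#)

  1≰0 : ¬ (1# ≤ 0#)
  1≰0 1≤0 = 0≢1 (antisym 0≤1 1≤0)

  fromℕ-nonneg : ∀ n → 0# ≤ fromℕ n
  fromℕ-nonneg zero = ≤-refl
  fromℕ-nonneg (suc n) = subst (_≤ 1# + fromℕ n) (+-identityˡ 0#) (+-mono₂-≤ 0≤1 (fromℕ-nonneg n))

  fromℕ-+ : ∀ m n → fromℕ (m ℕ.+ n) ≡ fromℕ m + fromℕ n
  fromℕ-+ zero n = sym (+-identityˡ (fromℕ n))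
  fromℕ-+ (suc m) n = trans (cong (1# +_) (fromℕ-+ m n)) (sym (+-assoc 1# (fromℕ m) (fromℕ n)))

  fromℕ-suc-* : ∀ n x → fromℕ (suc n) * x ≡ x + fromℕ n * x
  fromℕ-suc-* n x = trans (distribʳ x 1# (fromℕ n)) (cong (_+ fromℕ n * x) (*-identityˡ x))

  fromℕ-1-* : ∀ x → fromℕ 1 * x ≡ x
  fromℕ-1-* x = trans (fromℕ-suc-* 0 x) (trans (cong (x +_) (zeroˡ x)) (+-identityʳ x))

  fromℕ-2-* : ∀ x → fromℕ 2 * x ≡ x + x
  fromℕ-2-* x = trans (fromℕ-suc-* 1 x) (cong (x +_) (fromℕ-1-* x))

  fromℕ≢0 : ∀ n → n ≢ 0 → fromℕ n ≢ 0#
  fromℕ≢0 zero n≢0 = ⊥-elim (n≢0 refl)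
  fromℕ≢0 (suc n) _ 1+n≡0 = 1≰0 (subst (1# ≤_) 1+n≡0 1≤1+n)
    where
    1≤1+n : 1# ≤ 1# + fromℕ n
    1≤1+n = subst (_≤ 1# + fromℕ n) (+-identityʳ 1#) (+-monoʳ-≤ 1# (fromℕ-nonneg n))

  ⁻¹-nonneg : ∀ {c} → 0# ≤ c → c ≢ 0# → 0# ≤ c ⁻¹
  ⁻¹-nonneg {c} 0≤c c≢0 with total 0# (c ⁻¹)
  ... | inj₁ 0≤c⁻¹ = 0≤c⁻¹
  ... | inj₂ c⁻¹≤0 = ⊥-elim (1≰0 (0≤−⇒≤ (subst (0# ≤_) c*-c⁻¹≡0−1 (*-nonneg c _ 0≤c 0≤-c⁻¹))))
    where
    0≤-c⁻¹ : 0# ≤ - (c ⁻¹)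
    0≤-c⁻¹ = subst (0# ≤_) (+-identityˡ _) (≤⇒0≤− c⁻¹≤0)
    c*-c⁻¹≡0−1 : c * - (c ⁻¹) ≡ 0# − 1#
    c*-c⁻¹≡0−1 = begin-equality
      c * - (c ⁻¹)   ≡⟨ sym (-‿distribʳ-* c (c ⁻¹)) ⟩
      - (c * c ⁻¹)   ≡⟨ cong -_ (*-inverse c c≢0) ⟩
      - 1#           ≡⟨ sym (+-identityˡ (- 1#)) ⟩
      0# − 1#        ∎

  ⁻¹-*-cancel : ∀ {c} → c ≢ 0# → ∀ x → c ⁻¹ * (c * x) ≡ x
  ⁻¹-*-cancel {c} c≢0 x = begin-equality
    c ⁻¹ * (c * x)   ≡⟨ sym (*-assoc (c ⁻¹) c x) ⟩
    c ⁻¹ * c * x     ≡⟨ cong (_* x) (trans (*-comm (c ⁻¹) c) (*-inverse c c≢0)) ⟩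
    1# * x           ≡⟨ *-identityˡ x ⟩
    x                ∎

  *-⁻¹-cancel : ∀ {c} → c ≢ 0# → ∀ x → c * (c ⁻¹ * x) ≡ x
  *-⁻¹-cancel {c} c≢0 x = begin-equality
    c * (c ⁻¹ * x)   ≡⟨ sym (*-assoc c (c ⁻¹) x) ⟩
    c * c ⁻¹ * x     ≡⟨ cong (_* x) (*-inverse c c≢0) ⟩
    1# * x           ≡⟨ *-identityˡ x ⟩
    x                ∎

  ≤-divide : ∀ {c x s} → 0# ≤ c → c ≢ 0# → c * x ≤ s → x ≤ c ⁻¹ * s
  ≤-divide {c} {x} {s} 0≤c c≢0 cx≤s = begin
    x                ≡⟨ sym (⁻¹-*-cancel c≢0 x) ⟩
    c ⁻¹ * (c * x)   ≤⟨ *-monoˡ-≤ (⁻¹-nonneg 0≤c c≢0) cx≤s ⟩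
    c ⁻¹ * s         ∎

  ≤-multiply : ∀ {c x s} → 0# ≤ c → c ≢ 0# → x ≤ c ⁻¹ * s → c * x ≤ s
  ≤-multiply {c} {x} {s} 0≤c c≢0 x≤s/c = begin
    c * x            ≤⟨ *-monoˡ-≤ 0≤c x≤s/c ⟩
    c * (c ⁻¹ * s)   ≡⟨ *-⁻¹-cancel c≢0 s ⟩
    s                ∎

  scale-sum : ∀ h a b u v → h * (b * u + a * v) ≡ b * h * u + a * h * v
  scale-sum h a b u v = trans (distribˡ h _ _) (cong₂ _+_ (pull b u) (pull a v))
    where
    pull : ∀ k w → h * (k * w) ≡ k * h * w
    pull k w = trans (sym (*-assoc h k w)) (cong (_* w) (*-comm h k))

  sum-of-pair : ∀ {A : Set} (f : A → K) (l : List A) → length l ≡ 2 →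
                ∀ {p q} → p ∈ l → q ∈ l → p ≢ q → sumK (map f l) ≡ f p + f q
  sum-of-pair f (u ∷ v ∷ []) refl (here refl) (here refl) p≢q = ⊥-elim (p≢q refl)
  sum-of-pair f (u ∷ v ∷ []) refl (here refl) (there (here refl)) _ = cong (f u +_) (+-identityʳ (f v))
  sum-of-pair f (u ∷ v ∷ []) refl (there (here refl)) (here refl) _ = trans (cong (f u +_) (+-identityʳ (f v))) (+-comm (f u) (f v))
  sum-of-pair f (u ∷ v ∷ []) refl (there (here refl)) (there (here refl)) p≢q = ⊥-elim (p≢q refl)

module MidpointConvexSequences (F : OrderedField) where
  open OrderedField F
  open OrderedFieldFacts F
  open RingIdentities F
  open IsCommutativeRing isCommutativeRing using (+-identityˡ; +-identityʳ; zeroˡ)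

  MidpointConvex : (ℕ → K) → ℕ → Set
  MidpointConvex g c = ∀ k → suc (suc k) ℕ.≤ c → g (suc k) + g (suc k) ≤ g k + g (suc (suc k))

  module _ {g : ℕ → K} {c : ℕ} (convex : MidpointConvex g c) where

    increment : ℕ → K
    increment k = g (suc k) − g k

    increment-step : ∀ k → suc (suc k) ℕ.≤ c → increment k ≤ increment (suc k)
    increment-step k k+2≤c = exchange (convex k k+2≤c)

    increment-mono : ∀ {i j} → i ℕ.≤ j → suc j ℕ.≤ c → increment i ≤ increment j
    increment-mono i≤j = go (ℕₚ.≤⇒≤′ i≤j)
      where
      go : ∀ {i j} → i ≤′ j → suc j ℕ.≤ c → increment i ≤ increment j
      go (≤′-reflexive refl) _ = ≤-refl
      go (≤′-step {j} i≤′j) j+2≤c =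
        ≤-trans (go i≤′j (ℕₚ.≤-trans (ℕₚ.n≤1+n _) j+2≤c)) (increment-step j j+2≤c)

    growth-before : ∀ {a} → suc a ℕ.≤ c → ∀ k → k ℕ.≤ a → g k ≤ g 0 + fromℕ k * increment a
    growth-before {a} _ zero _ = ≤-reflexive (sym (trans (cong (g 0 +_) (zeroˡ _)) (+-identityʳ (g 0))))
    growth-before {a} a<c (suc k) k<a = begin
      g (suc k)                                ≡⟨ sym (+-− (g k) (g (suc k))) ⟩
      g k + increment k                        ≤⟨ +-mono₂-≤ (growth-before a<c k (ℕₚ.<⇒≤ k<a))
                                                             (increment-mono (ℕₚ.<⇒≤ k<a) a<c) ⟩
      (g 0 + fromℕ k * increment a) + increment a   ≡⟨ add-one-more (g 0) (fromℕ k) (increment a) ⟩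
      g 0 + (increment a + fromℕ k * increment a)   ≡⟨ cong (g 0 +_) (sym (fromℕ-suc-* k (increment a))) ⟩
      g 0 + fromℕ (suc k) * increment a        ∎

    growth-after : ∀ {a} m → a ℕ.+ m ℕ.≤ c → g a + fromℕ m * increment a ≤ g (a ℕ.+ m)
    growth-after {a} zero _ = ≤-reflexive (begin-equality
      g a + fromℕ 0 * increment a   ≡⟨ cong (g a +_) (zeroˡ _) ⟩
      g a + 0#                      ≡⟨ +-identityʳ (g a) ⟩
      g a                           ≡⟨ cong g (sym (ℕₚ.+-identityʳ a)) ⟩
      g (a ℕ.+ 0)                   ∎)
    growth-after {a} (suc m) a+m+1≤c = begin
      g a + fromℕ (suc m) * increment a               ≡⟨ cong (g a +_) (fromℕ-suc-* m (increment a)) ⟩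
      g a + (increment a + fromℕ m * increment a)     ≡⟨ sym (add-one-more (g a) (fromℕ m) (increment a)) ⟩
      (g a + fromℕ m * increment a) + increment a     ≤⟨ +-mono₂-≤ (growth-after m (ℕₚ.≤-trans (ℕₚ.n≤1+n _) a+m<c))
                                                                   (increment-mono (ℕₚ.m≤m+n a m) a+m<c) ⟩
      g (a ℕ.+ m) + increment (a ℕ.+ m)               ≡⟨ +-− (g (a ℕ.+ m)) (g (suc (a ℕ.+ m))) ⟩
      g (suc (a ℕ.+ m))                               ≡⟨ cong g (sym (ℕₚ.+-suc a m)) ⟩
      g (a ℕ.+ suc m)                                 ∎
      where
      a+m<c : suc (a ℕ.+ m) ℕ.≤ c
      a+m<c = subst (ℕ._≤ c) (ℕₚ.+-suc a m) a+m+1≤c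

    chord : ∀ a b → a ℕ.+ b ≡ c → fromℕ c * g a ≤ fromℕ b * g 0 + fromℕ a * g c
    chord a zero refl rewrite ℕₚ.+-identityʳ a =
      ≤-reflexive (sym (trans (cong (_+ fromℕ a * g a) (zeroˡ (g 0))) (+-identityˡ _)))
    chord a (suc b) refl = begin
      fromℕ (a ℕ.+ suc b) * g a                           ≡⟨ cong (_* g a) (fromℕ-+ a (suc b)) ⟩
      (fromℕ a + fromℕ (suc b)) * g a                     ≡⟨ split-sum (fromℕ a) (fromℕ (suc b)) (g a) ⟩
      fromℕ (suc b) * g a + fromℕ a * g a                 ≤⟨ +-mono-≤ _ _ _ (*-monoˡ-≤ (fromℕ-nonneg (suc b))
                                                                 (growth-before a<c a ℕₚ.≤-refl)) ⟩
      fromℕ (suc b) * (g 0 + fromℕ a * increment a) + fromℕ a * g a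
                                                          ≡⟨ shift-chord (fromℕ a) (fromℕ (suc b)) (g 0) (g a) (increment a) ⟩
      fromℕ (suc b) * g 0 + fromℕ a * (g a + fromℕ (suc b) * increment a)
                                                          ≤⟨ +-monoʳ-≤ _ (*-monoˡ-≤ (fromℕ-nonneg a)
                                                                 (growth-after (suc b) ℕₚ.≤-refl)) ⟩
      fromℕ (suc b) * g 0 + fromℕ a * g (a ℕ.+ suc b)     ∎
      where
      a<c : suc a ℕ.≤ a ℕ.+ suc b
      a<c = ℕₚ.m<m+n a (s≤s z≤n)

module Walks (G : Graph) where
  open Graph G

  NoShorterWalk : X → X → ℕ → Set
  NoShorterWalk x y n = ∀ m → Walk x y m → n ℕ.≤ m

  walk-length-0 : ∀ {x y} → Walk x y 0 → x ≡ y
  walk-length-0 [] = refl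

  walk-length≢0 : ∀ {x y n} → x ≢ y → Walk x y n → n ≢ 0
  walk-length≢0 x≢y w refl = x≢y (walk-length-0 w)

  infixr 5 _++ʷ_
  _++ʷ_ : ∀ {x y z m n} → Walk x y m → Walk y z n → Walk x z (m ℕ.+ n)
  [] ++ʷ w = w
  (e ∷ v) ++ʷ w = e ∷ (v ++ʷ w)

  -- The i-th vertex of a walk (its endpoint once i exceeds the length).
  vertexAt : ∀ {x y n} → Walk x y n → ℕ → X
  vertexAt {x} [] _ = x
  vertexAt {x} (e ∷ w) zero = x
  vertexAt (e ∷ w) (suc i) = vertexAt w i

  vertexAt-start : ∀ {x y n} (w : Walk x y n) → vertexAt w 0 ≡ x
  vertexAt-start [] = refl
  vertexAt-start (e ∷ w) = refl

  vertexAt-end : ∀ {x y n} (w : Walk x y n) → vertexAt w n ≡ y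
  vertexAt-end [] = refl
  vertexAt-end (e ∷ w) = vertexAt-end w

  vertexAt-join : ∀ {x y z m n} (v : Walk x y m) (w : Walk y z n) → vertexAt (v ++ʷ w) m ≡ y
  vertexAt-join [] w = vertexAt-start w
  vertexAt-join (e ∷ v) w = vertexAt-join v w

  vertexAt-adjacent : ∀ {x y n} (w : Walk x y n) i → suc i ℕ.≤ n → vertexAt w i ∼ vertexAt w (suc i)
  vertexAt-adjacent (e ∷ w) zero _ = subst (_ ∼_) (sym (vertexAt-start w)) e
  vertexAt-adjacent (e ∷ w) (suc i) (s≤s i<n) = vertexAt-adjacent w i i<n

  prefix : ∀ {x y n} (w : Walk x y n) i → i ℕ.≤ n → Walk x (vertexAt w i) i
  prefix [] zero _ = []
  prefix (e ∷ w) zero _ = []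
  prefix (e ∷ w) (suc i) (s≤s i≤n) = e ∷ prefix w i i≤n

  suffix : ∀ {x y n} (w : Walk x y n) i → Walk (vertexAt w i) y (n ℕ.∸ i)
  suffix [] zero = []
  suffix [] (suc i) = []
  suffix (e ∷ w) zero = e ∷ w
  suffix (e ∷ w) (suc i) = suffix w i

  -- A shortest walk never returns to the vertex it visited two steps
  -- earlier: otherwise cutting out that detour would give a shorter walk.
  shortest-no-backtrack : ∀ {x y n} (w : Walk x y n) → NoShorterWalk x y n →
                          ∀ i → suc (suc i) ℕ.≤ n → vertexAt w i ≢ vertexAt w (suc (suc i))
  shortest-no-backtrack {x} {y} {n} w shortest i i+2≤n vᵢ≡vᵢ₊₂ =
    ℕₚ.<-irrefl refl (ℕₚ.<-≤-trans i+k<n (shortest _ detour-free))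
    where
    k = n ℕ.∸ suc (suc i)
    detour-free : Walk x y (i ℕ.+ k)
    detour-free = prefix w i (ℕₚ.≤-trans (ℕₚ.n≤1+n i) (ℕₚ.≤-trans (ℕₚ.n≤1+n _) i+2≤n))
                  ++ʷ subst (λ v → Walk v y k) (sym vᵢ≡vᵢ₊₂) (suffix w (suc (suc i)))
    i+k<n : i ℕ.+ k ℕ.< n
    i+k<n = subst (i ℕ.+ k ℕ.<_) (ℕₚ.m+[n∸m]≡n i+2≤n) (ℕₚ.n≤1+n (suc (i ℕ.+ k)))

  adjacent-dist : ∀ {x y} → x ∼ y → Dist x y 1
  adjacent-dist {x} x∼y = (x∼y ∷ []) , λ
    { zero w → ⊥-elim (∼-irrefl (subst (x ∼_) (sym (walk-length-0 w)) x∼y))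
    ; (suc m) _ → s≤s z≤n }

  common-neighbour-dist : TriangleFree → ∀ {x p q} → x ∼ p → x ∼ q → p ≢ q → Dist p q 2
  common-neighbour-dist triangle-free {x} {p} {q} x∼p x∼q p≢q = (∼-sym x∼p ∷ x∼q ∷ []) , λ
    { zero w → ⊥-elim (p≢q (walk-length-0 w))
    ; (suc zero) (p∼q ∷ []) → ⊥-elim (triangle-free x p q x∼p p∼q (∼-sym x∼q))
    ; (suc (suc m)) _ → s≤s (s≤s z≤n) }

module TwoRegularGraphs (F : OrderedField) (G : Graph) (two-regular : Graph.RegularOfDegree G 2) where
  open OrderedField F
  open Graph G
  open OrderedFieldFacts F
  open MidpointConvexSequences F using (MidpointConvex; chord)
  open Walks G
  open IsCommutativeRing isCommutativeRing using (distribˡ)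

  module _ (f : X → K) where

    subharmonic-midpoint : Subharmonic F G f → ∀ {v p q} → v ∼ p → v ∼ q → p ≢ q →
                           f v + f v ≤ f p + f q
    subharmonic-midpoint subharmonic {v} {p} {q} v∼p v∼q p≢q = begin
      f v + f v        ≡⟨ sym (fromℕ-2-* (f v)) ⟩
      fromℕ 2 * f v    ≤⟨ ≤-multiply (fromℕ-nonneg 2) (fromℕ≢0 2 (λ ())) mean-bound ⟩
      f p + f q        ∎
      where
      mean-bound : f v ≤ fromℕ 2 ⁻¹ * (f p + f q)
      mean-bound = subst₂ (λ d s → f v ≤ fromℕ d ⁻¹ * s)
                     (two-regular v) (sum-of-pair f (nbrs v) (two-regular v) v∼p v∼q p≢q) (subharmonic v)

    subharmonic-along-shortest : Subharmonic F G f → ∀ {x y n} (w : Walk x y n) →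
                                 NoShorterWalk x y n → MidpointConvex (λ k → f (vertexAt w k)) n
    subharmonic-along-shortest subharmonic w shortest k k+2≤n =
      subharmonic-midpoint subharmonic
        (∼-sym (vertexAt-adjacent w k (ℕₚ.≤-trans (ℕₚ.n≤1+n _) k+2≤n)))
        (vertexAt-adjacent w (suc k) k+2≤n)
        (shortest-no-backtrack w shortest k k+2≤n)

    -- For z between x and y, the walk x ⇝ z ⇝ y is shortest, so the chord
    -- inequality along it, divided by d(x,y) ≠ 0, is convexity at z.
    subharmonic⇒convex : Subharmonic F G f → Convex F G f
    subharmonic⇒convex subharmonic x y z a b .(a ℕ.+ b) x≢y
                       ((w₁ , _) , (w₂ , _) , (_ , shortest) , refl) = begin
      f z                                               ≤⟨ ≤-divide (fromℕ-nonneg (a ℕ.+ b)) C≢0 chord-through-z ⟩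
      C ⁻¹ * (fromℕ b * f x + fromℕ a * f y)            ≡⟨ scale-sum (C ⁻¹) (fromℕ a) (fromℕ b) (f x) (f y) ⟩
      fromℕ b * C ⁻¹ * f x + fromℕ a * C ⁻¹ * f y       ∎
      where
      C = fromℕ (a ℕ.+ b)
      w = w₁ ++ʷ w₂
      C≢0 : C ≢ 0#
      C≢0 = fromℕ≢0 (a ℕ.+ b) (walk-length≢0 x≢y w)
      chord-through-z : C * f z ≤ fromℕ b * f x + fromℕ a * f y
      chord-through-z = begin
        C * f z                                            ≡⟨ cong (λ v → C * f v) (sym (vertexAt-join w₁ w₂)) ⟩
        C * f (vertexAt w a)                               ≤⟨ chord (subharmonic-along-shortest subharmonic w shortest) a b refl ⟩
        fromℕ b * f (vertexAt w 0) + fromℕ a * f (vertexAt w (a ℕ.+ b))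
                                                           ≡⟨ cong₂ (λ u v → fromℕ b * f u + fromℕ a * f v)
                                                                (vertexAt-start w) (vertexAt-end w) ⟩
        fromℕ b * f x + fromℕ a * f y                      ∎

    -- The two neighbours p, q of x satisfy d(p,x) = d(x,q) = 1 and d(p,q) = 2,
    -- so convexity for x between p and q is subharmonicity at x.
    convex⇒subharmonic : TriangleFree → Convex F G f → Subharmonic F G f
    convex⇒subharmonic triangle-free convex x =
      let p , q , x∼p , x∼q , p≢q = pair-of-distinct (nbrs x) (nbrs-unique x) (two-regular x)
          x-between-p-q = adjacent-dist (∼-sym x∼p) , adjacent-dist x∼q ,
                          common-neighbour-dist triangle-free x∼p x∼q p≢q , refl
      in begin
      f x                                       ≤⟨ convex p q x 1 1 2 p≢q x-between-p-q ⟩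
      fromℕ 1 * h * f p + fromℕ 1 * h * f q     ≡⟨ cong₂ _+_ (cong (_* f p) (fromℕ-1-* h)) (cong (_* f q) (fromℕ-1-* h)) ⟩
      h * f p + h * f q                         ≡⟨ sym (distribˡ h (f p) (f q)) ⟩
      h * (f p + f q)                           ≡⟨ cong₂ (λ d s → fromℕ d ⁻¹ * s) (sym (two-regular x))
                                                     (sym (sum-of-pair f (nbrs x) (two-regular x) x∼p x∼q p≢q)) ⟩
      fromℕ (deg x) ⁻¹ * sumK (map f (nbrs x))  ∎
      where
      h : K
      h = fromℕ 2 ⁻¹

mainTheorem8 : (F : OrderedField) (G : Graph) →
    Graph.Connected G → Graph.RegularOfDegree G 2 → Graph.TriangleFree G →
    (f : Graph.X G → OrderedField.K F) → Subharmonic F G f ⇔ Convex F G f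
mainTheorem8 F G _ two-regular triangle-free f =
  mk⇔ (subharmonic⇒convex f) (convex⇒subharmonic f triangle-free)
  where open TwoRegularGraphs F G two-regular
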